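{- Let $s$ be a sign pattern with $s(u_{n2})=-$. If any of the following holds: (i) $(s(u_{in}),s(u_{i1}),s(u_{i2}))=(+,-,+)$ for some $i\in[n]\setminus\{1,2,3,n-1,n\}$; (ii) $(s(u_{1,n-1}),s(u_{2,n-1}))=(-,+)$; (iii) $(s(u_{3n}),s(u_{13}))=(+,-)$; then $s$ is not consistent.
   Context: Labels $1,\dots,n$ are cyclic mod $n$; a chord of the $n$-gon is an unordered pair $\{i,j\}$ with $j\notin\{i-1,i,i+1\}$. The dihedral coordinates of $\mathcal{M}_{0,n}$ (the moduli space of $n$ distinct points $z_i$ on $\mathbb{P}^1$) are $u_{ij}=[i,i+1|j+1,j]$ for chords $ij$, where $[ij|kl]=\frac{(z_i-z_k)(z_j-z_l)}{(z_i-z_l)(z_j-z_k)}$; $u_{ij}=u_{ji}$. A sign pattern $s$ assigns $\pm$ to each $u_{ij}$. For every partition of the labels into four non-empty cyclic intervals $A=(a,\dots,b-1)$, $B=(b,\dots,c-1)$, $C=(c,\dots,d-1)$, $D=(d,\dots,a-1)$, the extended $u$-relation $\prod_{i\in A,j\in C}u_{ij}+\prod_{k\in B,l\in D}u_{kl}=1$ holds on $\mathcal{M}_{0,n}$. $s$ is consistent if for no such partition are both monomials negative under $s$ (sign of a monomial = product of the signs of its factors). -}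

module Defs where

open import Data.Nat using (ℕ; zero; suc; _+_; _∸_; _<_; NonZero)
open import Data.Nat.DivMod using (_mod_)
open import Data.Fin using (Fin; toℕ)
open import Data.List using (List; []; _∷_; map; upTo; concatMap; foldr)
open import Data.Product using (_×_)
open import Relation.Binary.PropositionalEquality using (_≡_)
open import Relation.Nullary using (¬_)

data Sign : Set where
  pos neg : Sign

_·_ : Sign → Sign → Sign
pos · s = s
neg · pos = neg
neg · neg = pos

prodSign : List Sign → Sign
prodSign = foldr _·_ pos

-- Labels 1,…,n of the paper are represented by Fin n, label k ↦ index k-1.
-- A sign pattern assigns a sign to each u_ij, symmetric since u_ij = u_ji.
-- (Values on non-chords {i,i}, {i,i+1} are never used by consistency.)
record SignPattern (n : ℕ) : Set where
  field
    sgn : Fin n → Fin n → Sign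
    sym : ∀ i j → sgn i j ≡ sgn j i
open SignPattern public

module _ {n : ℕ} .{{_ : NonZero n}} where

  lab : ℕ → Fin n
  lab k = (k ∸ 1) mod n

  u : SignPattern n → ℕ → ℕ → Sign
  u s i j = sgn s (lab i) (lab j)

  range : ℕ → ℕ → List ℕ
  range lo hi = map (lo +_) (upTo (hi ∸ lo))

  shift : Fin n → ℕ → Fin n
  shift a t = (toℕ a + t) mod n

  monoSign : SignPattern n → Fin n → ℕ → ℕ → ℕ → ℕ → Sign
  monoSign s a lo₁ hi₁ lo₂ hi₂ =
    prodSign (concatMap (λ t → map (λ t' → sgn s (shift a t) (shift a t')) (range lo₂ hi₂)) (range lo₁ hi₁))

  -- Every partition into four non-empty cyclic intervals A,B,C,D is given by a start label a
  -- and offsets 0 < p < q < r < n:  A = a+[0,p), B = a+[p,q), C = a+[q,r), D = a+[r,n).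
  -- s is consistent if for no such partition both ∏_{A×C} u and ∏_{B×D} u are negative.
  Consistent : SignPattern n → Set
  Consistent s = ∀ (a : Fin n) (p q r : ℕ) → 0 < p → p < q → q < r → r < n →
    ¬ (monoSign s a 0 p q r ≡ neg × monoSign s a p q r n ≡ neg)

{-# OPTIONS --safe #-}
module Submission where

-- Each condition is refuted by chaining partitions.  With s(u_n2) = −, consistency at a
-- first partition forces the sign of a product of u's, and that sign makes both monomials
-- negative at a second partition.  (iii): {1}{2}{3..n-1}{n} forces ∏_{4≤j<n} u_1j = −, which
-- {1}{2,3}{4..n-1}{n} forbids.  (ii): {1}{2}{3..n-1}{n} forces ∏_{3≤j<n-1} u_1j = −, which
-- {1}{2}{3..n-2}{n-1,n} forbids.  (i): {1}{2..i-1}{i..n-1}{n} and {1}{2..i}{i+1..n-1}{n}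
-- together force B = ∏_{3≤x<i} u_xn = −; then {1,2}{3..i-1}{i}{i+1..n} forces
-- ∏_{3≤x<i, i<y<n} u_xy = B = −, which {3..i-1}{i}{i+1..n-1}{n,1,2} forbids.

open import Defs hiding (sym)
open import Algebra.Bundles using (CommutativeSemigroup)
import Algebra.Properties.CommutativeSemigroup as CommutativeSemigroupProperties
open import Data.Empty using (⊥)
open import Data.Fin using (toℕ)
open import Data.Fin.Properties using (toℕ-injective; toℕ-fromℕ<)
open import Data.List using (List; []; _∷_; _++_; map; concat; applyUpTo)
open import Data.List.Properties using (map-applyUpTo; map-∘)
open import Data.Nat using (ℕ; zero; suc; _+_; _∸_; _≤_; _<_; NonZero; z≤n; s≤s; z<s)
open import Data.Nat.DivMod using (_mod_; _%_; m%n<n; %-distribˡ-+; m%n%n≡m%n; [m+n]%n≡m%n)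
open import Data.Nat.Properties
  using (_<?_; +-comm; +-suc; +-identityʳ; +-∸-assoc; [m+n]∸[m+o]≡n∸o; m+[n∸m]≡n; m∸n+n≡m;
         n∸n≡0; m≤n⇒m∸n≡0; m<n⇒0<n∸m; m<n+o⇒m∸n<o; ∸-monoˡ-<; ∸-monoʳ-<; +-monoʳ-≤;
         ≮⇒≥; <⇒≤; <-trans; ≤-trans; n<1+n; n≤1+n; m≤n+m)
open import Data.Product using (∃; _×_; _,_)
open import Data.Sum using (_⊎_; inj₁; inj₂)
open import Function using (id; _∘_)
open import Level using (0ℓ)
open import Relation.Binary.PropositionalEquality
open import Relation.Nullary using (¬_; yes; no; contradiction)

·-comm : ∀ x y → x · y ≡ y · x
·-comm pos pos = refl
·-comm pos neg = refl
·-comm neg pos = refl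
·-comm neg neg = refl

·-assoc : ∀ x y z → (x · y) · z ≡ x · (y · z)
·-assoc pos y   z   = refl
·-assoc neg pos z   = refl
·-assoc neg neg pos = refl
·-assoc neg neg neg = refl

·-identityʳ : ∀ x → x · pos ≡ x
·-identityʳ pos = refl
·-identityʳ neg = refl

·-commutativeSemigroup : CommutativeSemigroup 0ℓ 0ℓ
·-commutativeSemigroup = record
  { Carrier = Sign
  ; _≈_     = _≡_
  ; _∙_     = _·_
  ; isCommutativeSemigroup = record
    { isSemigroup = record
      { isMagma = record { isEquivalence = isEquivalence ; ∙-cong = cong₂ _·_ }
      ; assoc   = ·-assoc
      }
    ; comm = ·-comm
    }
  }

open CommutativeSemigroupProperties ·-commutativeSemigroup using (interchange)

·≡pos⇒≡ : ∀ {x y} → x · y ≡ pos → x ≡ y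
·≡pos⇒≡ {pos} {pos} _  = refl
·≡pos⇒≡ {pos} {neg} ()
·≡pos⇒≡ {neg} {pos} ()
·≡pos⇒≡ {neg} {neg} _  = refl

¬neg⇒pos : ∀ {x} → ¬ x ≡ neg → x ≡ pos
¬neg⇒pos {pos} _      = refl
¬neg⇒pos {neg} x≢neg = contradiction refl x≢neg

¬pos⇒neg : ∀ {x} → ¬ x ≡ pos → x ≡ neg
¬pos⇒neg {pos} x≢pos = contradiction refl x≢pos
¬pos⇒neg {neg} _      = refl

prodSign-++ : ∀ xs ys → prodSign (xs ++ ys) ≡ prodSign xs · prodSign ys
prodSign-++ []       ys = refl
prodSign-++ (x ∷ xs) ys = trans (cong (x ·_) (prodSign-++ xs ys)) (sym (·-assoc x _ _))

prodSign-concat : ∀ xss → prodSign (concat xss) ≡ prodSign (map prodSign xss)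
prodSign-concat []         = refl
prodSign-concat (xs ∷ xss) =
  trans (prodSign-++ xs (concat xss)) (cong (prodSign xs ·_) (prodSign-concat xss))

prod : (ℕ → Sign) → ℕ → ℕ → Sign
prod g lo zero    = pos
prod g lo (suc k) = g lo · prod g (suc lo) k

Π : (ℕ → Sign) → ℕ → ℕ → Sign
Π g lo hi = prod g lo (hi ∸ lo)

prod-cong : ∀ {f g : ℕ → Sign} → (∀ t → f t ≡ g t) → ∀ lo k → prod f lo k ≡ prod g lo k
prod-cong f≗g lo zero    = refl
prod-cong f≗g lo (suc k) = cong₂ _·_ (f≗g lo) (prod-cong f≗g (suc lo) k)

prod-distrib : ∀ (f g : ℕ → Sign) lo k → prod (λ t → f t · g t) lo k ≡ prod f lo k · prod g lo k
prod-distrib f g lo zero    = refl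
prod-distrib f g lo (suc k) =
  trans (cong ((f lo · g lo) ·_) (prod-distrib f g (suc lo) k)) (interchange (f lo) (g lo) _ _)

prod-snoc : ∀ (g : ℕ → Sign) lo k → prod g lo (suc k) ≡ prod g lo k · g (lo + k)
prod-snoc g lo zero    = trans (·-identityʳ (g lo)) (cong g (sym (+-identityʳ lo)))
prod-snoc g lo (suc k) = begin
  g lo · prod g (suc lo) (suc k)              ≡⟨ cong (g lo ·_) (prod-snoc g (suc lo) k) ⟩
  g lo · (prod g (suc lo) k · g (suc lo + k)) ≡⟨ ·-assoc (g lo) _ _ ⟨
  prod g lo (suc k) · g (suc lo + k)          ≡⟨ cong (λ t → prod g lo (suc k) · g t) (+-suc lo k) ⟨
  prod g lo (suc k) · g (lo + suc k)          ∎
  where open ≡-Reasoning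

prod-shift : ∀ (g : ℕ → Sign) m lo k → prod (λ t → g (t + m)) lo k ≡ prod g (lo + m) k
prod-shift g m lo zero    = refl
prod-shift g m lo (suc k) = cong (g (lo + m) ·_) (prod-shift g m (suc lo) k)

prodSign-applyUpTo : ∀ (f g : ℕ → Sign) lo k → (∀ t → f t ≡ g (lo + t)) →
                     prodSign (applyUpTo f k) ≡ prod g lo k
prodSign-applyUpTo f g lo zero    f≗g = refl
prodSign-applyUpTo f g lo (suc k) f≗g = cong₂ _·_
  (trans (f≗g 0) (cong g (+-identityʳ lo)))
  (prodSign-applyUpTo (f ∘ suc) g (suc lo) k (λ t → trans (f≗g (suc t)) (cong g (+-suc lo t))))

Π-cong : ∀ {f g : ℕ → Sign} lo hi → (∀ t → f t ≡ g t) → Π f lo hi ≡ Π g lo hi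
Π-cong lo hi f≗g = prod-cong f≗g lo (hi ∸ lo)

Π-distrib : ∀ {f g : ℕ → Sign} lo hi → Π (λ t → f t · g t) lo hi ≡ Π f lo hi · Π g lo hi
Π-distrib {f} {g} lo hi = prod-distrib f g lo (hi ∸ lo)

module _ {g : ℕ → Sign} where

  Π-empty : ∀ lo → Π g lo lo ≡ pos
  Π-empty lo = cong (prod g lo) (n∸n≡0 lo)

  Π-neg⇒< : ∀ {lo hi} → Π g lo hi ≡ neg → lo < hi
  Π-neg⇒< {lo} {hi} Π≡neg with lo <? hi
  ... | yes lo<hi = lo<hi
  ... | no  lo≮hi = contradiction (trans (cong (prod g lo) (sym (m≤n⇒m∸n≡0 (≮⇒≥ lo≮hi)))) Π≡neg) λ ()

  Π-cons : ∀ {lo hi} → lo < hi → Π g lo hi ≡ g lo · Π g (suc lo) hi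
  Π-cons {lo} (s≤s lo≤hi) = cong (prod g lo) (+-∸-assoc 1 lo≤hi)

  Π-snoc : ∀ {lo hi} → lo < hi → Π g lo hi ≡ Π g lo (hi ∸ 1) · g (hi ∸ 1)
  Π-snoc {lo} {suc hi} (s≤s lo≤hi) = begin
    prod g lo (suc hi ∸ lo)                  ≡⟨ cong (prod g lo) (+-∸-assoc 1 lo≤hi) ⟩
    prod g lo (suc (hi ∸ lo))                ≡⟨ prod-snoc g lo (hi ∸ lo) ⟩
    prod g lo (hi ∸ lo) · g (lo + (hi ∸ lo)) ≡⟨ cong (λ t → Π g lo hi · g t) (m+[n∸m]≡n lo≤hi) ⟩
    Π g lo hi · g hi                         ∎
    where open ≡-Reasoning

  Π-singleton : ∀ lo → Π g lo (suc lo) ≡ g lo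
  Π-singleton lo = trans (Π-snoc (n<1+n lo)) (cong (_· g lo) (Π-empty lo))

  Π-shift : ∀ m lo hi → Π (λ t → g (t + m)) lo hi ≡ Π g (lo + m) (hi + m)
  Π-shift m lo hi = begin
    prod (λ t → g (t + m)) lo (hi ∸ lo)   ≡⟨ prod-shift g m lo (hi ∸ lo) ⟩
    prod g (lo + m) (hi ∸ lo)             ≡⟨ cong (prod g (lo + m)) [hi+m]∸[lo+m]≡hi∸lo ⟨
    prod g (lo + m) ((hi + m) ∸ (lo + m)) ∎
    where
    open ≡-Reasoning
    [hi+m]∸[lo+m]≡hi∸lo : (hi + m) ∸ (lo + m) ≡ hi ∸ lo
    [hi+m]∸[lo+m]≡hi∸lo = trans (cong₂ _∸_ (+-comm hi m) (+-comm lo m)) ([m+n]∸[m+o]≡n∸o m hi lo)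

-- The blocks are the label intervals A = [a,b), B = [b,c), C = [c,d) and D = [d,a+n), read mod n.
record Partition (n : ℕ) : Set where
  constructor partition
  field
    a b c d : ℕ
    0<a   : 0 < a
    a<b   : a < b
    b<c   : b < c
    c<d   : c < d
    d<a+n : d < a + n

module _ {n : ℕ} .{{_ : NonZero n}} where

  private
    toℕ-mod : ∀ m → toℕ (m mod n) ≡ m % n
    toℕ-mod m = toℕ-fromℕ< (m%n<n m n)

    mod-cong : ∀ {m m′} → m % n ≡ m′ % n → m mod n ≡ m′ mod n
    mod-cong {m} {m′} eq = toℕ-injective (trans (toℕ-mod m) (trans eq (sym (toℕ-mod m′))))

  shift-lab : ∀ x t → shift (lab {n} (suc x)) t ≡ lab (t + suc x)
  shift-lab x t = mod-cong (begin
    (toℕ (x mod n) + t) % n ≡⟨ cong (λ v → (v + t) % n) (toℕ-mod x) ⟩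
    (x % n + t) % n         ≡⟨ %-distribˡ-+ (x % n) t n ⟩
    (x % n % n + t % n) % n ≡⟨ cong (λ v → (v + t % n) % n) (m%n%n≡m%n x n) ⟩
    (x % n + t % n) % n     ≡⟨ %-distribˡ-+ x t n ⟨
    (x + t) % n             ≡⟨ cong (_% n) (+-comm x t) ⟩
    (t + x) % n             ≡⟨ cong (λ v → (v ∸ 1) % n) (+-suc t x) ⟨
    (t + suc x ∸ 1) % n     ∎)
    where open ≡-Reasoning

  u-sym : ∀ (s : SignPattern n) x y → u s x y ≡ u s y x
  u-sym s x y = SignPattern.sym s (lab x) (lab y)

  u-periodic : ∀ (s : SignPattern n) x k → u s x (suc k + n) ≡ u s x (suc k)
  u-periodic s x k = cong (sgn s (lab x)) (mod-cong ([m+n]%n≡m%n k n))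

  Πu : SignPattern n → ℕ → ℕ → ℕ → ℕ → Sign
  Πu s a b c d = Π (λ x → Π (u s x) c d) a b

  Πu-singletonˡ : ∀ s a c d → Πu s a (suc a) c d ≡ Π (u s a) c d
  Πu-singletonˡ s a c d = Π-singleton a

  Πu-singletonʳ : ∀ s a b c → Πu s a b c (suc c) ≡ Π (λ x → u s x c) a b
  Πu-singletonʳ s a b c = Π-cong a b (λ x → Π-singleton c)

  Πu-singleton : ∀ s a c → Πu s a (suc a) c (suc c) ≡ u s a c
  Πu-singleton s a c = trans (Πu-singletonˡ s a c (suc c)) (Π-singleton c)

  prodSign-map-range : ∀ (g : ℕ → Sign) lo hi → prodSign (map g (range {n} lo hi)) ≡ Π g lo hi
  prodSign-map-range g lo hi = trans
    (cong prodSign (trans (cong (map g) (map-applyUpTo id (lo +_) k)) (map-applyUpTo (lo +_) g k)))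
    (prodSign-applyUpTo _ g lo k (λ _ → refl))
    where k = hi ∸ lo

  monoSign≡Πu : ∀ s x lo₁ hi₁ lo₂ hi₂ → let a = suc x in
    monoSign s (lab a) lo₁ hi₁ lo₂ hi₂ ≡ Πu s (lo₁ + a) (hi₁ + a) (lo₂ + a) (hi₂ + a)
  monoSign≡Πu s x lo₁ hi₁ lo₂ hi₂ = begin
    prodSign (concat (map F R₁))             ≡⟨ prodSign-concat (map F R₁) ⟩
    prodSign (map prodSign (map F R₁))       ≡⟨ cong prodSign (map-∘ R₁) ⟨
    prodSign (map (prodSign ∘ F) R₁)         ≡⟨ prodSign-map-range _ lo₁ hi₁ ⟩
    Π (prodSign ∘ F) lo₁ hi₁                 ≡⟨ Π-cong lo₁ hi₁ (λ t → prodSign-map-range _ lo₂ hi₂) ⟩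
    Π (λ t → Π (λ t′ → sgn s (shift a′ t) (shift a′ t′)) lo₂ hi₂) lo₁ hi₁
      ≡⟨ Π-cong lo₁ hi₁ (λ t → Π-cong lo₂ hi₂ (λ t′ → cong₂ (sgn s) (shift-lab x t) (shift-lab x t′))) ⟩
    Π (λ t → Π (λ t′ → u s (t + a) (t′ + a)) lo₂ hi₂) lo₁ hi₁
      ≡⟨ Π-cong lo₁ hi₁ (λ t → Π-shift a lo₂ hi₂) ⟩
    Π (λ t → Π (u s (t + a)) (lo₂ + a) (hi₂ + a)) lo₁ hi₁
      ≡⟨ Π-shift a lo₁ hi₁ ⟩
    Πu s (lo₁ + a) (hi₁ + a) (lo₂ + a) (hi₂ + a) ∎
    where
    open ≡-Reasoning
    a = suc x
    a′ = lab {n} a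
    R₁ = range {n} lo₁ hi₁
    F : ℕ → List Sign
    F t = map (λ t′ → sgn s (shift a′ t) (shift a′ t′)) (range {n} lo₂ hi₂)

  AC BD : SignPattern n → Partition n → Sign
  AC s P = Πu s a b c d where open Partition P
  BD s P = Πu s b c d (a + n) where open Partition P

  both-neg⇒inconsistent : ∀ s (P : Partition n) → AC s P ≡ neg → BD s P ≡ neg → ¬ Consistent s
  both-neg⇒inconsistent s (partition (suc x) b c d _ a<b b<c c<d d<a+n) AC≡neg BD≡neg C =
    C (lab a) (b ∸ a) (c ∸ a) (d ∸ a) (m<n⇒0<n∸m a<b) (∸-monoˡ-< b<c a≤b) (∸-monoˡ-< c<d a≤c)
      (m<n+o⇒m∸n<o d a d<a+n) (trans AC≡ AC≡neg , trans BD≡ BD≡neg)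
    where
    a = suc x
    a≤b = <⇒≤ a<b
    a≤c = <⇒≤ (<-trans a<b b<c)
    a≤d = <⇒≤ (<-trans (<-trans a<b b<c) c<d)
    AC≡ : monoSign s (lab a) 0 (b ∸ a) (c ∸ a) (d ∸ a) ≡ Πu s a b c d
    AC≡ rewrite monoSign≡Πu s x 0 (b ∸ a) (c ∸ a) (d ∸ a)
              | m∸n+n≡m a≤b | m∸n+n≡m a≤c | m∸n+n≡m a≤d = refl
    BD≡ : monoSign s (lab a) (b ∸ a) (c ∸ a) (d ∸ a) n ≡ Πu s b c d (a + n)
    BD≡ rewrite monoSign≡Πu s x (b ∸ a) (c ∸ a) (d ∸ a) n
              | m∸n+n≡m a≤b | m∸n+n≡m a≤c | m∸n+n≡m a≤d | +-comm n a = refl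

  AC-neg⇒BD-pos : ∀ s → Consistent s → (P : Partition n) → AC s P ≡ neg → BD s P ≡ pos
  AC-neg⇒BD-pos s C P AC≡neg = ¬neg⇒pos (λ BD≡neg → both-neg⇒inconsistent s P AC≡neg BD≡neg C)

  BD-neg⇒AC-pos : ∀ s → Consistent s → (P : Partition n) → BD s P ≡ neg → AC s P ≡ pos
  BD-neg⇒AC-pos s C P BD≡neg = ¬neg⇒pos (λ AC≡neg → both-neg⇒inconsistent s P AC≡neg BD≡neg C)

module _ {n : ℕ} .{{_ : NonZero n}} (s : SignPattern n) (C : Consistent s) (4≤n : 4 ≤ n)
         (un2≡neg : u s n 2 ≡ neg) where

  open ≡-Reasoning

  private
    u2n≡neg : u s 2 n ≡ neg
    u2n≡neg = trans (u-sym s 2 n) un2≡neg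

  case-iii : u s 3 n ≡ pos → u s 1 3 ≡ neg → ⊥
  case-iii u3n≡pos u13≡neg = both-neg⇒inconsistent s P₂ (trans (Πu-singletonˡ s 1 4 n) E≡neg) BD₂≡neg C
    where
    E = Π (u s 1) 4 n
    P₁ P₂ : Partition n
    P₁ = partition 1 2 3 n z<s (n<1+n 1) (n<1+n 2) 4≤n (n<1+n n)
    u13≡E : u s 1 3 ≡ E
    u13≡E = ·≡pos⇒≡ (begin
      u s 1 3 · E   ≡⟨ Π-cons 4≤n ⟨
      Π (u s 1) 3 n ≡⟨ Πu-singletonˡ s 1 3 n ⟨
      AC s P₁       ≡⟨ BD-neg⇒AC-pos s C P₁ (trans (Πu-singleton s 2 n) u2n≡neg) ⟩
      pos           ∎)
    E≡neg : E ≡ neg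
    E≡neg = trans (sym u13≡E) u13≡neg
    P₂ = partition 1 2 4 n z<s (n<1+n 1) (s≤s (s≤s (s≤s z≤n))) (Π-neg⇒< E≡neg) (n<1+n n)
    BD₂≡neg : BD s P₂ ≡ neg
    BD₂≡neg = begin
      Πu s 2 4 n (suc n)        ≡⟨ Πu-singletonʳ s 2 4 n ⟩
      u s 2 n · (u s 3 n · pos) ≡⟨ cong₂ (λ x y → x · (y · pos)) u2n≡neg u3n≡pos ⟩
      neg                       ∎

  case-ii : u s 1 (n ∸ 1) ≡ neg → u s 2 (n ∸ 1) ≡ pos → ⊥
  case-ii u1m≡neg u2m≡pos = both-neg⇒inconsistent s P₂ (trans (Πu-singletonˡ s 1 3 m) E≡neg) BD₂≡neg C
    where
    m = n ∸ 1
    m<n : m < n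
    m<n = ∸-monoʳ-< z<s (≤-trans (s≤s z≤n) 4≤n)
    E = Π (u s 1) 3 m
    P₁ P₂ : Partition n
    P₁ = partition 1 2 3 n z<s (n<1+n 1) (n<1+n 2) 4≤n (n<1+n n)
    E≡u1m : E ≡ u s 1 m
    E≡u1m = ·≡pos⇒≡ (begin
      E · u s 1 m   ≡⟨ Π-snoc 4≤n ⟨
      Π (u s 1) 3 n ≡⟨ Πu-singletonˡ s 1 3 n ⟨
      AC s P₁       ≡⟨ BD-neg⇒AC-pos s C P₁ (trans (Πu-singleton s 2 n) u2n≡neg) ⟩
      pos           ∎)
    E≡neg : E ≡ neg
    E≡neg = trans E≡u1m u1m≡neg
    P₂ = partition 1 2 3 m z<s (n<1+n 1) (n<1+n 2) (Π-neg⇒< E≡neg) (<-trans m<n (n<1+n n))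
    BD₂≡neg : BD s P₂ ≡ neg
    BD₂≡neg = begin
      Πu s 2 3 m (suc n)                  ≡⟨ Πu-singletonˡ s 2 m (suc n) ⟩
      Π (u s 2) m (suc n)                 ≡⟨ Π-snoc (<-trans m<n (n<1+n n)) ⟩
      Π (u s 2) m n · u s 2 n             ≡⟨ cong (_· u s 2 n) (Π-snoc m<n) ⟩
      (Π (u s 2) m m · u s 2 m) · u s 2 n ≡⟨ cong (λ x → (x · u s 2 m) · u s 2 n) (Π-empty m) ⟩
      u s 2 m · u s 2 n                   ≡⟨ cong₂ _·_ u2m≡pos u2n≡neg ⟩
      neg                                 ∎

  Π[3…i-1]u·n≡neg : ∀ {i} → 4 ≤ i → suc i < n → u s i n ≡ pos → u s i 1 ≡ neg →
                    Π (λ x → u s x n) 3 i ≡ neg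
  Π[3…i-1]u·n≡neg {i} 4≤i 1+i<n uin≡pos ui1≡neg = ¬pos⇒neg B≢pos
    where
    B = Π (λ x → u s x n) 3 i
    E = Π (u s 1) (suc i) n
    i<n : i < n
    i<n = <-trans (n<1+n i) 1+i<n
    2<i : 2 < i
    2<i = ≤-trans (n≤1+n 3) 4≤i
    B≢pos : ¬ B ≡ pos
    B≢pos B≡pos = both-neg⇒inconsistent s P₂ (trans (Πu-singletonˡ s 1 (suc i) n) E≡neg) BD₂≡neg C
      where
      P₁ P₂ : Partition n
      P₁ = partition 1 2 i n z<s (n<1+n 1) 2<i i<n (n<1+n n)
      BD₁≡neg : BD s P₁ ≡ neg
      BD₁≡neg = begin
        Πu s 2 i n (suc n)    ≡⟨ Πu-singletonʳ s 2 i n ⟩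
        Π (λ x → u s x n) 2 i ≡⟨ Π-cons 2<i ⟩
        u s 2 n · B           ≡⟨ cong₂ _·_ u2n≡neg B≡pos ⟩
        neg                   ∎
      u1i≡E : u s 1 i ≡ E
      u1i≡E = ·≡pos⇒≡ (begin
        u s 1 i · E   ≡⟨ Π-cons i<n ⟨
        Π (u s 1) i n ≡⟨ Πu-singletonˡ s 1 i n ⟨
        AC s P₁       ≡⟨ BD-neg⇒AC-pos s C P₁ BD₁≡neg ⟩
        pos           ∎)
      E≡neg : E ≡ neg
      E≡neg = trans (sym u1i≡E) (trans (u-sym s 1 i) ui1≡neg)
      P₂ = partition 1 2 (suc i) n z<s (n<1+n 1) (<-trans 2<i (n<1+n i)) 1+i<n (n<1+n n)
      BD₂≡neg : BD s P₂ ≡ neg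
      BD₂≡neg = begin
        Πu s 2 (suc i) n (suc n)              ≡⟨ Πu-singletonʳ s 2 (suc i) n ⟩
        Π (λ x → u s x n) 2 (suc i)           ≡⟨ Π-cons (<-trans 2<i (n<1+n i)) ⟩
        u s 2 n · Π (λ x → u s x n) 3 (suc i) ≡⟨ cong (u s 2 n ·_) (Π-snoc (s≤s 2<i)) ⟩
        u s 2 n · (B · u s i n)               ≡⟨ cong₂ (λ x y → u s 2 n · (x · y)) B≡pos uin≡pos ⟩
        u s 2 n · pos                         ≡⟨ cong (_· pos) u2n≡neg ⟩
        neg                                   ∎

  case-i : ∀ {i} → 4 ≤ i → i ≤ n ∸ 2 → u s i n ≡ pos → u s i 1 ≡ neg → u s i 2 ≡ pos → ⊥
  case-i {i} 4≤i i≤n∸2 uin≡pos ui1≡neg ui2≡pos = both-neg⇒inconsistent s P₄ Cc≡neg BD₄≡neg C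
    where
    1+i<n : suc i < n
    1+i<n = subst (2 + i ≤_) (m+[n∸m]≡n (≤-trans (m≤n+m 2 2) 4≤n)) (+-monoʳ-≤ 2 i≤n∸2)
    B≡neg : Π (λ x → u s x n) 3 i ≡ neg
    B≡neg = Π[3…i-1]u·n≡neg 4≤i 1+i<n uin≡pos ui1≡neg
    Cc = Πu s 3 i (suc i) n
    P₃ P₄ : Partition n
    P₃ = partition 1 3 i (suc i) z<s (s≤s (s≤s z≤n)) 4≤i (n<1+n i) (s≤s (<⇒≤ 1+i<n))
    AC₃≡neg : AC s P₃ ≡ neg
    AC₃≡neg = begin
      Πu s 1 3 i (suc i)        ≡⟨ Πu-singletonʳ s 1 3 i ⟩
      u s 1 i · (u s 2 i · pos) ≡⟨ cong₂ (λ x y → x · (y · pos)) (trans (u-sym s 1 i) ui1≡neg)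
                                                              (trans (u-sym s 2 i) ui2≡pos) ⟩
      neg                       ∎
    Cc≡B : Cc ≡ Π (λ x → u s x n) 3 i
    Cc≡B = ·≡pos⇒≡ (begin
      Cc · Π (λ x → u s x n) 3 i                   ≡⟨ Π-distrib 3 i ⟨
      Π (λ x → Π (u s x) (suc i) n · u s x n) 3 i  ≡⟨ Π-cong 3 i (λ x → Π-snoc (s≤s (<⇒≤ 1+i<n))) ⟨
      BD s P₃                                      ≡⟨ AC-neg⇒BD-pos s C P₃ AC₃≡neg ⟩
      pos                                          ∎)
    Cc≡neg : Cc ≡ neg
    Cc≡neg = trans Cc≡B B≡neg
    P₄ = partition 3 i (suc i) n z<s 4≤i (n<1+n i) 1+i<n (s≤s (m≤n+m n 2))
    BD₄≡neg : BD s P₄ ≡ neg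
    BD₄≡neg = begin
      Πu s i (suc i) n (3 + n)                           ≡⟨ Πu-singletonˡ s i n (3 + n) ⟩
      Π (u s i) n (3 + n)                                ≡⟨ Π-shift n 0 3 ⟨
      u s i n · (u s i (1 + n) · (u s i (2 + n) · pos))  ≡⟨ cong₂ (λ x y → u s i n · (x · (y · pos)))
                                                                   (u-periodic s i 0) (u-periodic s i 1) ⟩
      u s i n · (u s i 1 · (u s i 2 · pos))              ≡⟨ cong₂ (λ x y → x · (y · (u s i 2 · pos)))
                                                                   uin≡pos ui1≡neg ⟩
      neg · (u s i 2 · pos)                              ≡⟨ cong (λ x → neg · (x · pos)) ui2≡pos ⟩
      neg                                                ∎

lemma3p3 : (n : ℕ) .{{_ : NonZero n}} → 4 ≤ n → (s : SignPattern n) →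
    u s n 2 ≡ neg →
    ( (∃ λ i → 4 ≤ i × i ≤ n ∸ 2 × u s i n ≡ pos × u s i 1 ≡ neg × u s i 2 ≡ pos)
    ⊎ (u s 1 (n ∸ 1) ≡ neg × u s 2 (n ∸ 1) ≡ pos)
    ⊎ (u s 3 n ≡ pos × u s 1 3 ≡ neg) ) →
    ¬ Consistent s
lemma3p3 n 4≤n s un2≡neg (inj₁ (i , 4≤i , i≤n∸2 , uin , ui1 , ui2)) C =
  case-i s C 4≤n un2≡neg 4≤i i≤n∸2 uin ui1 ui2
lemma3p3 n 4≤n s un2≡neg (inj₂ (inj₁ (u1m , u2m))) C = case-ii s C 4≤n un2≡neg u1m u2m
lemma3p3 n 4≤n s un2≡neg (inj₂ (inj₂ (u3n , u13))) C = case-iii s C 4≤n un2≡neg u3n u13
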